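{- Let $h\ge0$ and let $\psi_i^{(h)}(z)$ be the generating function, by length, of reversed Deutsch paths staying within the strip $0\le y\le h$ and ending at level $i$ ($0\le i\le h$). Then \[ \psi_0^{(h)}=\frac{1+v+v^2}{1+v}\cdot\frac{1-v^{h+2}}{1-v^{h+3}}, \] and for $1\le i\le h$, \[ \psi_i^{(h)}=v(1+v+v^2)(1+v)^{i-2}\,\frac{1-v^{h+1-i}}{1-v^{h+3}} . \]
   Context: A reversed Deutsch path of length $n$ is a lattice path starting at $(0,0)$ consisting of $n$ steps, each either a step $(1,-1)$ or a step $(1,k)$ for some integer $k\ge1$, which never goes below the $x$-axis (equivalently, the left-to-right reading of a Deutsch path traversed from right to left, where Deutsch paths have steps $(1,1)$ and $(1,-k)$, $k\ge1$). The empty path counts as ending at level $0$. Let $v=v(z)=\frac{1-z-\sqrt{1-2z-3z^2}}{2z}$, the formal power series satisfying $z=\frac{v}{1+v+v^2}$. -}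

module Defs where

open import Data.Nat using (ℕ; zero; suc; _≤_; _∸_) renaming (_+_ to _+ℕ_)
open import Data.Integer using (ℤ; 0ℤ; 1ℤ) renaming (_+_ to _+ℤ_; _*_ to _*ℤ_; -_ to -ℤ_)
open import Data.List using (List; []; _∷_; length)
open import Data.Product using (Σ; _×_)
open import Relation.Binary.PropositionalEquality using (_≡_)

-- Formal power series in z with integer coefficients: coefficient maps.

PS : Set
PS = ℕ → ℤ

infix  4 _≈ₛ_
infixl 6 _+ₛ_ _-ₛ_
infixl 7 _*ₛ_
infixr 8 _^ₛ_

_≈ₛ_ : PS → PS → Set
f ≈ₛ g = ∀ n → f n ≡ g n

_+ₛ_ : PS → PS → PS
(f +ₛ g) n = f n +ℤ g n

-ₛ_ : PS → PS
(-ₛ f) n = -ℤ (f n)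

_-ₛ_ : PS → PS → PS
f -ₛ g = f +ₛ (-ₛ g)

const : ℤ → PS
const c zero    = c
const c (suc _) = 0ℤ

𝟙 : PS
𝟙 = const 1ℤ

zₛ : PS
zₛ zero          = 0ℤ
zₛ (suc zero)    = 1ℤ
zₛ (suc (suc _)) = 0ℤ

convSum : PS → PS → ℕ → ℕ → ℤ
convSum f g n zero    = f 0 *ℤ g n
convSum f g n (suc m) = convSum f g n m +ℤ f (suc m) *ℤ g (n ∸ suc m)

_*ₛ_ : PS → PS → PS
(f *ₛ g) n = convSum f g n n

_^ₛ_ : PS → ℕ → PS
f ^ₛ zero  = 𝟙
f ^ₛ suc k = f *ₛ (f ^ₛ k)

ofℕ : (ℕ → ℕ) → PS
ofℕ f n = Data.Integer.+ (f n)

-- Reversed Deutsch paths.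
-- Steps: D = (1,-1);  U k = (1, k+1)  (so every up step has height ≥ 1).

data Step : Set where
  D : Step
  U : ℕ → Step

-- InStrip h a s i : the step sequence s, started at level a, stays in
-- the strip 0 ≤ y ≤ h at every visited point and ends at level i.
-- (Nonnegativity is automatic since levels are natural numbers.)
data InStrip (h : ℕ) : ℕ → List Step → ℕ → Set where
  done  : ∀ {a} → a ≤ h → InStrip h a [] a
  stepD : ∀ {a s i} → suc a ≤ h → InStrip h a s i → InStrip h (suc a) (D ∷ s) i
  stepU : ∀ {a k s i} → a ≤ h → InStrip h (a +ℕ suc k) s i → InStrip h a (U k ∷ s) i

StripPath : (h n i : ℕ) → Set
StripPath h n i = Σ (List Step) (λ s → length s ≡ n × InStrip h 0 s i)

-- Let P_i(n) count the strip paths of length n ending at level i and let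
-- X_i = Σₙ P_i(n) zⁿ.  Cutting off the last step of a path gives
--   P_i(n+1) = P_{i+1}(n) + Σ_{j<i} P_j(n)  (i ≤ h),   P_i(0) = [i = 0],
-- and P_{h+1} = 0.  Differencing in i removes the sum and yields the linear
-- system  ΔX_i = s_i + z·∇X_i  (0 ≤ i ≤ h),  X_{h+1} = 0,  where Δ, ∇ are
-- difference operators in the level and s = (1, −1, 0, 0, …).  With
-- w = 1 + v + v², K_h = (1 + v)(1 − v^{h+3}) and z·w = v, the series X_i·K_h
-- solve  w·ΔY_i = s_i·w·K_h + v·∇Y_i,  and so do the closed forms of the
-- theorem (polynomial identities in v).  Because w(0) = 1 and v(0) = 0 this
-- system determines its solution degree by degree, so the two agree.
module Submission where

open import Defs
open import Data.Nat using (ℕ; zero; suc; _≤_; _<_; _+_; _∸_; z≤n; s≤s)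
import Data.Nat.Properties as ℕP
open import Data.Integer as ℤ using (ℤ; 0ℤ; 1ℤ; -1ℤ; +_)
  renaming (_+_ to _+ℤ_; _*_ to _*ℤ_; -_ to -ℤ_)
import Data.Integer.Properties as ℤP
open import Data.Integer.Solver using (module +-*-Solver)
open import Data.Product using (Σ-syntax; _×_; _,_; proj₁; proj₂)
open import Data.Sum using (_⊎_; inj₁; inj₂)
open import Data.List using (List; []; _∷_; _++_; _∷ʳ_; length; _∷ʳ′_; initLast)
open import Data.List.Properties using (length-++; ∷ʳ-injectiveˡ; ∷ʳ-injectiveʳ)
open import Data.Fin using (Fin)
open import Data.Fin.Properties using (+↔⊎; 0↔⊥; 1↔⊤)
open import Data.Fin.Permutation using (↔⇒≡)
open import Data.Unit using (tt)
open import Data.Empty using (⊥-elim)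
open import Data.Maybe using (Maybe; just; nothing)
open import Data.Sum.Function.Propositional using (_⊎-↔_)
open import Function.Bundles using (_↔_; mk↔ₛ′)
open import Function.Properties.Inverse using (↔-trans; ↔-sym)
open import Relation.Nullary using (¬_; yes; no)
open import Relation.Binary.PropositionalEquality
open import Algebra.Bundles using (CommutativeRing)
open import Algebra.Solver.Ring.AlmostCommutativeRing
  using (fromCommutativeRing; _-Raw-AlmostCommutative⟶_)
import Algebra.Solver.Ring
import Relation.Binary.Reasoning.Setoid

0ₛ : PS
0ₛ = const 0ℤ

0ₛ-coeff : ∀ n → 0ₛ n ≡ 0ℤ
0ₛ-coeff zero    = refl
0ₛ-coeff (suc n) = refl

tailₛ : PS → PS
tailₛ f k = f (suc k)

-- The Cauchy product computed by peeling off the constant term of the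
-- left factor: f·g = f₀·g + z·(tail f)·g.  All ring laws are proved for
-- this form, which recurses on a single index.
mulRec : PS → PS → ℕ → ℤ
mulRec f g zero    = f 0 *ℤ g 0
mulRec f g (suc n) = f 0 *ℤ g (suc n) +ℤ mulRec (tailₛ f) g n

convSum-suc : ∀ f g n m →
  convSum f g (suc n) (suc m) ≡ f 0 *ℤ g (suc n) +ℤ convSum (tailₛ f) g n m
convSum-suc f g n zero    = refl
convSum-suc f g n (suc m) =
  trans (cong (_+ℤ f (suc (suc m)) *ℤ g (n ∸ suc m)) (convSum-suc f g n m))
        (ℤP.+-assoc (f 0 *ℤ g (suc n)) (convSum (tailₛ f) g n m) _)

*ₛ-mulRec : ∀ f g n → (f *ₛ g) n ≡ mulRec f g n
*ₛ-mulRec f g zero    = refl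
*ₛ-mulRec f g (suc n) =
  trans (convSum-suc f g n n) (cong (f 0 *ℤ g (suc n) +ℤ_) (*ₛ-mulRec (tailₛ f) g n))

interchange : ∀ a b c d → (a +ℤ b) +ℤ (c +ℤ d) ≡ (a +ℤ c) +ℤ (b +ℤ d)
interchange = solve 4 (λ a b c d → (a :+ b) :+ (c :+ d) := (a :+ c) :+ (b :+ d)) refl
  where open +-*-Solver

mulRec-cong : ∀ {f f′ g g′} → f ≈ₛ f′ → g ≈ₛ g′ → ∀ n → mulRec f g n ≡ mulRec f′ g′ n
mulRec-cong f≈ g≈ zero    = cong₂ _*ℤ_ (f≈ 0) (g≈ 0)
mulRec-cong f≈ g≈ (suc n) =
  cong₂ _+ℤ_ (cong₂ _*ℤ_ (f≈ 0) (g≈ (suc n))) (mulRec-cong (λ k → f≈ (suc k)) g≈ n)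

mulRec-zeroˡ : ∀ {f} g n → (∀ k → f k ≡ 0ℤ) → mulRec f g n ≡ 0ℤ
mulRec-zeroˡ g zero    f≡0 = cong (_*ℤ g 0) (f≡0 0)
mulRec-zeroˡ g (suc n) f≡0 =
  trans (cong₂ _+ℤ_ (cong (_*ℤ g (suc n)) (f≡0 0)) (mulRec-zeroˡ g n (λ k → f≡0 (suc k))))
        (ℤP.+-identityˡ _)

mulRec-zeroʳ : ∀ f g n → (∀ k → k ≤ n → g k ≡ 0ℤ) → mulRec f g n ≡ 0ℤ
mulRec-zeroʳ f g zero    g≡0 = trans (cong (f 0 *ℤ_) (g≡0 0 z≤n)) (ℤP.*-zeroʳ (f 0))
mulRec-zeroʳ f g (suc n) g≡0 =
  trans (cong₂ _+ℤ_ (trans (cong (f 0 *ℤ_) (g≡0 (suc n) ℕP.≤-refl)) (ℤP.*-zeroʳ (f 0)))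
                    (mulRec-zeroʳ (tailₛ f) g n (λ k k≤n → g≡0 k (ℕP.m≤n⇒m≤1+n k≤n))))
        (ℤP.+-identityˡ 0ℤ)

mulRec-identityˡ : ∀ g n → mulRec 𝟙 g n ≡ g n
mulRec-identityˡ g zero    = ℤP.*-identityˡ (g 0)
mulRec-identityˡ g (suc n) =
  trans (cong₂ _+ℤ_ (ℤP.*-identityˡ (g (suc n))) (mulRec-zeroˡ g n (λ _ → refl)))
        (ℤP.+-identityʳ _)

mulRec-distribʳ : ∀ f f′ g n → mulRec (f +ₛ f′) g n ≡ mulRec f g n +ℤ mulRec f′ g n
mulRec-distribʳ f f′ g zero    = ℤP.*-distribʳ-+ (g 0) (f 0) (f′ 0)
mulRec-distribʳ f f′ g (suc n) =
  trans (cong₂ _+ℤ_ (ℤP.*-distribʳ-+ (g (suc n)) (f 0) (f′ 0))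
                    (mulRec-distribʳ (tailₛ f) (tailₛ f′) g n))
        (interchange (f 0 *ℤ g (suc n)) (f′ 0 *ℤ g (suc n)) _ _)

mulRec-distribˡ : ∀ f g g′ n → mulRec f (g +ₛ g′) n ≡ mulRec f g n +ℤ mulRec f g′ n
mulRec-distribˡ f g g′ zero    = ℤP.*-distribˡ-+ (f 0) (g 0) (g′ 0)
mulRec-distribˡ f g g′ (suc n) =
  trans (cong₂ _+ℤ_ (ℤP.*-distribˡ-+ (f 0) (g (suc n)) (g′ (suc n)))
                    (mulRec-distribˡ (tailₛ f) g g′ n))
        (interchange (f 0 *ℤ g (suc n)) (f 0 *ℤ g′ (suc n)) _ _)

mulRec-scale : ∀ c f g n → mulRec (λ k → c *ℤ f k) g n ≡ c *ℤ mulRec f g n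
mulRec-scale c f g zero    = ℤP.*-assoc c (f 0) (g 0)
mulRec-scale c f g (suc n) =
  trans (cong₂ _+ℤ_ (ℤP.*-assoc c (f 0) (g (suc n))) (mulRec-scale c (tailₛ f) g n))
        (sym (ℤP.*-distribˡ-+ c (f 0 *ℤ g (suc n)) (mulRec (tailₛ f) g n)))

mulRec-peelʳ : ∀ f g n → mulRec f g (suc n) ≡ mulRec f (tailₛ g) n +ℤ f (suc n) *ℤ g 0
mulRec-peelʳ f g zero    = refl
mulRec-peelʳ f g (suc n) =
  trans (cong (f 0 *ℤ g (suc (suc n)) +ℤ_) (mulRec-peelʳ (tailₛ f) g n))
        (sym (ℤP.+-assoc (f 0 *ℤ g (suc (suc n))) (mulRec (tailₛ f) (tailₛ g) n) _))

mulRec-comm : ∀ f g n → mulRec f g n ≡ mulRec g f n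
mulRec-comm f g zero    = ℤP.*-comm (f 0) (g 0)
mulRec-comm f g (suc n) =
  trans (cong₂ _+ℤ_ (ℤP.*-comm (f 0) (g (suc n))) (mulRec-comm (tailₛ f) g n))
        (trans (ℤP.+-comm (g (suc n) *ℤ f 0) (mulRec g (tailₛ f) n)) (sym (mulRec-peelʳ g f n)))

mulRec-assoc : ∀ f g k n → mulRec (mulRec f g) k n ≡ mulRec f (mulRec g k) n
mulRec-assoc f g k zero    = ℤP.*-assoc (f 0) (g 0) (k 0)
mulRec-assoc f g k (suc n) = begin
    (f 0 *ℤ g 0) *ℤ k (suc n) +ℤ mulRec (tailₛ (mulRec f g)) k n
  ≡⟨ cong ((f 0 *ℤ g 0) *ℤ k (suc n) +ℤ_)
          (mulRec-distribʳ (λ m → f 0 *ℤ g (suc m)) (mulRec (tailₛ f) g) k n) ⟩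
    (f 0 *ℤ g 0) *ℤ k (suc n) +ℤ (mulRec (λ m → f 0 *ℤ g (suc m)) k n +ℤ mulRec (mulRec (tailₛ f) g) k n)
  ≡⟨ cong₂ (λ a b → (f 0 *ℤ g 0) *ℤ k (suc n) +ℤ (a +ℤ b))
           (mulRec-scale (f 0) (tailₛ g) k n) (mulRec-assoc (tailₛ f) g k n) ⟩
    (f 0 *ℤ g 0) *ℤ k (suc n) +ℤ (f 0 *ℤ mulRec (tailₛ g) k n +ℤ mulRec (tailₛ f) (mulRec g k) n)
  ≡⟨ regroup (f 0) (g 0) (k (suc n)) (mulRec (tailₛ g) k n) (mulRec (tailₛ f) (mulRec g k) n) ⟩
    f 0 *ℤ (g 0 *ℤ k (suc n) +ℤ mulRec (tailₛ g) k n) +ℤ mulRec (tailₛ f) (mulRec g k) n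
  ∎
  where
  open ≡-Reasoning
  open +-*-Solver
  regroup : ∀ a b c d e → (a *ℤ b) *ℤ c +ℤ (a *ℤ d +ℤ e) ≡ a *ℤ (b *ℤ c +ℤ d) +ℤ e
  regroup = solve 5 (λ a b c d e → (a :* b) :* c :+ (a :* d :+ e) := a :* (b :* c :+ d) :+ e) refl

*ₛ-cong : ∀ {f f′ g g′} → f ≈ₛ f′ → g ≈ₛ g′ → f *ₛ g ≈ₛ f′ *ₛ g′
*ₛ-cong {f} {f′} {g} {g′} f≈ g≈ n =
  trans (*ₛ-mulRec f g n) (trans (mulRec-cong f≈ g≈ n) (sym (*ₛ-mulRec f′ g′ n)))

*ₛ-assoc : ∀ f g k → (f *ₛ g) *ₛ k ≈ₛ f *ₛ (g *ₛ k)
*ₛ-assoc f g k n =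
  trans (*ₛ-mulRec (f *ₛ g) k n)
  (trans (mulRec-cong (*ₛ-mulRec f g) (λ _ → refl) n)
  (trans (mulRec-assoc f g k n)
  (trans (mulRec-cong (λ _ → refl) (λ m → sym (*ₛ-mulRec g k m)) n)
         (sym (*ₛ-mulRec f (g *ₛ k) n)))))

*ₛ-comm : ∀ f g → f *ₛ g ≈ₛ g *ₛ f
*ₛ-comm f g n = trans (*ₛ-mulRec f g n) (trans (mulRec-comm f g n) (sym (*ₛ-mulRec g f n)))

*ₛ-identityˡ : ∀ f → 𝟙 *ₛ f ≈ₛ f
*ₛ-identityˡ f n = trans (*ₛ-mulRec 𝟙 f n) (mulRec-identityˡ f n)

*ₛ-distribʳ : ∀ k f g → (f +ₛ g) *ₛ k ≈ₛ f *ₛ k +ₛ g *ₛ k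
*ₛ-distribʳ k f g n =
  trans (*ₛ-mulRec (f +ₛ g) k n)
  (trans (mulRec-distribʳ f g k n) (sym (cong₂ _+ℤ_ (*ₛ-mulRec f k n) (*ₛ-mulRec g k n))))

*ₛ-distribˡ : ∀ k f g → k *ₛ (f +ₛ g) ≈ₛ k *ₛ f +ₛ k *ₛ g
*ₛ-distribˡ k f g n =
  trans (*ₛ-mulRec k (f +ₛ g) n)
  (trans (mulRec-distribˡ k f g n) (sym (cong₂ _+ℤ_ (*ₛ-mulRec k f n) (*ₛ-mulRec k g n))))

psRing : CommutativeRing _ _
psRing = record
  { Carrier = PS ; _≈_ = _≈ₛ_ ; _+_ = _+ₛ_ ; _*_ = _*ₛ_ ; -_ = -ₛ_ ; 0# = 0ₛ ; 1# = 𝟙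
  ; isCommutativeRing = record
    { isRing = record
      { +-isAbelianGroup = record
        { isGroup = record
          { isMonoid = record
            { isSemigroup = record
              { isMagma = record
                { isEquivalence = record
                  { refl = λ _ → refl ; sym = λ e n → sym (e n) ; trans = λ e e′ n → trans (e n) (e′ n) }
                ; ∙-cong = λ e e′ n → cong₂ _+ℤ_ (e n) (e′ n) }
              ; assoc = λ f g k n → ℤP.+-assoc (f n) (g n) (k n) }
            ; identity = (λ f n → trans (cong (_+ℤ f n) (0ₛ-coeff n)) (ℤP.+-identityˡ (f n)))
                       , (λ f n → trans (cong (f n +ℤ_) (0ₛ-coeff n)) (ℤP.+-identityʳ (f n))) }
          ; inverse = (λ f n → trans (ℤP.+-inverseˡ (f n)) (sym (0ₛ-coeff n)))
                    , (λ f n → trans (ℤP.+-inverseʳ (f n)) (sym (0ₛ-coeff n)))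
          ; ⁻¹-cong = λ e n → cong -ℤ_ (e n) }
        ; comm = λ f g n → ℤP.+-comm (f n) (g n) }
      ; *-cong = *ₛ-cong
      ; *-assoc = *ₛ-assoc
      ; *-identity = *ₛ-identityˡ , (λ f n → trans (*ₛ-comm f 𝟙 n) (*ₛ-identityˡ f n))
      ; distrib = *ₛ-distribˡ , *ₛ-distribʳ }
    ; *-comm = *ₛ-comm } }

-- Integer constants embed into the ring of series; this makes the ring
-- solver available for identities between series with integer coefficients.
const-*-const : ∀ a b n → (const a *ₛ const b) (suc n) ≡ 0ℤ
const-*-const a b n =
  trans (*ₛ-mulRec (const a) (const b) (suc n))
        (cong₂ _+ℤ_ (ℤP.*-zeroʳ a) (mulRec-zeroˡ (const b) n (λ _ → refl)))

constHom : CommutativeRing.rawRing ℤP.+-*-commutativeRing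
             -Raw-AlmostCommutative⟶ fromCommutativeRing psRing
constHom = record
  { ⟦_⟧ = const
  ; +-homo = λ { a b zero → refl ; a b (suc n) → refl }
  ; *-homo = λ { a b zero → refl ; a b (suc n) → sym (const-*-const a b n) }
  ; -‿homo = λ { a zero → refl ; a (suc n) → refl }
  ; 0-homo = λ _ → refl
  ; 1-homo = λ { zero → refl ; (suc n) → refl } }

const-equal? : ∀ a b → Maybe (const a ≈ₛ const b)
const-equal? a b with a ℤ.≟ b
... | yes refl = just (λ _ → refl)
... | no _     = nothing

module PS-Solver =
  Algebra.Solver.Ring (CommutativeRing.rawRing ℤP.+-*-commutativeRing)
                      (fromCommutativeRing psRing) constHom const-equal?

open CommutativeRing psRing using (+-cong; *-cong; -‿cong; +-congˡ; *-congˡ; *-congʳ)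
  renaming (refl to ≈-refl; sym to ≈-sym; trans to ≈-trans; reflexive to ≈-reflexive)

VanishesBelow : ℕ → PS → Set
VanishesBelow n g = ∀ k → k < n → g k ≡ 0ℤ

leading-coefficient : ∀ f g n → VanishesBelow n g → (f *ₛ g) n ≡ f 0 *ℤ g n
leading-coefficient f g zero    _   = refl
leading-coefficient f g (suc n) g<n =
  trans (*ₛ-mulRec f g (suc n))
        (trans (cong (f 0 *ℤ g (suc n) +ℤ_) (mulRec-zeroʳ (tailₛ f) g n (λ k k≤n → g<n k (s≤s k≤n))))
               (ℤP.+-identityʳ _))

z*-zero : ∀ f → (zₛ *ₛ f) 0 ≡ 0ℤ
z*-zero f = ℤP.*-zeroˡ (f 0)

z*-suc : ∀ f n → (zₛ *ₛ f) (suc n) ≡ f n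
z*-suc f n =
  trans (*ₛ-mulRec zₛ f (suc n))
  (trans (cong₂ _+ℤ_ (ℤP.*-zeroˡ (f (suc n))) (mulRec-cong tail-z≈𝟙 (λ _ → refl) n))
  (trans (ℤP.+-identityˡ _) (mulRec-identityˡ f n)))
  where
  tail-z≈𝟙 : tailₛ zₛ ≈ₛ 𝟙
  tail-z≈𝟙 zero    = refl
  tail-z≈𝟙 (suc k) = refl

by-shift : ∀ {f g c} → f 0 ≡ c → (∀ n → f (suc n) ≡ g n) → f ≈ₛ const c +ₛ zₛ *ₛ g
by-shift {g = g} {c} f₀ f₊ zero    = trans f₀ (sym (trans (cong (c +ℤ_) (z*-zero g)) (ℤP.+-identityʳ c)))
by-shift {g = g}     f₀ f₊ (suc n) = trans (f₊ n) (sym (trans (ℤP.+-identityˡ _) (z*-suc g n)))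

-- An integer identity: differencing the last-step recurrence in the level
-- eliminates the sum over lower levels (used in `Counting`).
level-difference : ∀ a b c s → + (a + (c + s)) +ℤ -ℤ + (b + s) ≡ (+ a +ℤ -ℤ + b) +ℤ + c
level-difference a b c s =
  trans (cong₂ (λ x y → x +ℤ -ℤ y) (trans (ℤP.pos-+ a (c + s)) (cong (+ a +ℤ_) (ℤP.pos-+ c s)))
                                   (ℤP.pos-+ b s))
        (solve 4 (λ a b c s → (a :+ (c :+ s)) :- (b :+ s) := (a :- b) :+ c) refl (+ a) (+ b) (+ c) (+ s))
  where open +-*-Solver

module ≈-Reasoning = Relation.Binary.Reasoning.Setoid (CommutativeRing.setoid psRing)
open PS-Solver using (solve; _:=_; con; _:+_; _:*_; _:-_; _:^_)

-- Differencing the last-step recurrence of strip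
-- paths produces exactly these two combinations.
Δ : (ℕ → PS) → ℕ → PS
Δ F zero    = F 0
Δ F (suc i) = F (suc i) -ₛ F i

∇ : (ℕ → PS) → ℕ → PS
∇ F zero    = F 1
∇ F (suc i) = F (suc (suc i)) -ₛ F (suc i) +ₛ F i

Δ-sub : ∀ F G i → Δ (λ j → F j -ₛ G j) i ≈ₛ Δ F i -ₛ Δ G i
Δ-sub F G zero    = ≈-refl
Δ-sub F G (suc i) =
  solve 4 (λ a b c d → (a :- b) :- (c :- d) := (a :- c) :- (b :- d)) ≈-refl
    (F (suc i)) (G (suc i)) (F i) (G i)

∇-sub : ∀ F G i → ∇ (λ j → F j -ₛ G j) i ≈ₛ ∇ F i -ₛ ∇ G i
∇-sub F G zero    = ≈-refl
∇-sub F G (suc i) =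
  solve 6 (λ a b c d e f → (a :- b) :- (c :- d) :+ (e :- f) := (a :- c :+ e) :- (b :- d :+ f)) ≈-refl
    (F (suc (suc i))) (G (suc (suc i))) (F (suc i)) (G (suc i)) (F i) (G i)

Δ-scale : ∀ F K i → Δ (λ j → F j *ₛ K) i ≈ₛ Δ F i *ₛ K
Δ-scale F K zero    = ≈-refl
Δ-scale F K (suc i) =
  solve 3 (λ a b k → a :* k :- b :* k := (a :- b) :* k) ≈-refl (F (suc i)) (F i) K

∇-scale : ∀ F K i → ∇ (λ j → F j *ₛ K) i ≈ₛ ∇ F i *ₛ K
∇-scale F K zero    = ≈-refl
∇-scale F K (suc i) =
  solve 4 (λ a b c k → a :* k :- b :* k :+ c :* k := (a :- b :+ c) :* k) ≈-refl
    (F (suc (suc i))) (F (suc i)) (F i) K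

record Solves (h : ℕ) (w v : PS) (c F : ℕ → PS) : Set where
  field
    equation : ∀ i → i ≤ h → w *ₛ Δ F i ≈ₛ c i +ₛ v *ₛ ∇ F i
    boundary : F (suc h) ≈ₛ 0ₛ

Solves-sub : ∀ {h w v c F G} → Solves h w v c F → Solves h w v c G →
  Solves h w v (λ _ → 0ₛ) (λ i → F i -ₛ G i)
Solves-sub {h} {w} {v} {c} {F} {G} F-solves G-solves = record
  { equation = λ i i≤h → begin
      w *ₛ Δ (λ j → F j -ₛ G j) i
    ≈⟨ *-congˡ {w} (Δ-sub F G i) ⟩
      w *ₛ (Δ F i -ₛ Δ G i)
    ≈⟨ solve 3 (λ w a b → w :* (a :- b) := w :* a :- w :* b) ≈-refl w (Δ F i) (Δ G i) ⟩
      w *ₛ Δ F i -ₛ w *ₛ Δ G i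
    ≈⟨ +-cong (F.equation i i≤h) (-‿cong (G.equation i i≤h)) ⟩
      (c i +ₛ v *ₛ ∇ F i) -ₛ (c i +ₛ v *ₛ ∇ G i)
    ≈⟨ solve 4 (λ c v a b → (c :+ v :* a) :- (c :+ v :* b) := con 0ℤ :+ v :* (a :- b)) ≈-refl
         (c i) v (∇ F i) (∇ G i) ⟩
      0ₛ +ₛ v *ₛ (∇ F i -ₛ ∇ G i)
    ≈⟨ +-congˡ {0ₛ} (*-congˡ {v} (≈-sym (∇-sub F G i))) ⟩
      0ₛ +ₛ v *ₛ ∇ (λ j → F j -ₛ G j) i
    ∎
  ; boundary = λ n → trans (cong₂ (λ a b → a +ℤ -ℤ b) (F.boundary n) (G.boundary n))
                           (trans (ℤP.+-inverseʳ (0ₛ n)) (sym (0ₛ-coeff n)))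
  }
  where
  open ≈-Reasoning
  module F = Solves F-solves
  module G = Solves G-solves

-- When w₀ = 1 and v₀ = 0, the equation at level i read in
-- degree n expresses (ΔE_i)ₙ through coefficients of degree < n; so by
-- induction on n all coefficients of a homogeneous solution vanish.
module Uniqueness {h : ℕ} {w v : PS} (w₀ : w 0 ≡ 1ℤ) (v₀ : v 0 ≡ 0ℤ)
                  {E : ℕ → PS} (E-solves : Solves h w v (λ _ → 0ₛ) E) where
  open Solves E-solves

  Vanish : ℕ → Set
  Vanish n = ∀ i → i ≤ suc h → VanishesBelow n (E i)

  Δ-vanishes : ∀ {n} → Vanish n → ∀ i → i ≤ h → VanishesBelow n (Δ E i)
  Δ-vanishes V zero    _     k k<n = V 0 z≤n k k<n
  Δ-vanishes V (suc i) 1+i≤h k k<n =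
    cong₂ (λ a b → a +ℤ -ℤ b) (V (suc i) (ℕP.m≤n⇒m≤1+n 1+i≤h) k k<n)
                              (V i (ℕP.m≤n⇒m≤1+n (ℕP.<⇒≤ 1+i≤h)) k k<n)

  ∇-vanishes : ∀ {n} → Vanish n → ∀ i → i ≤ h → VanishesBelow n (∇ E i)
  ∇-vanishes V zero    _     k k<n = V 1 (s≤s z≤n) k k<n
  ∇-vanishes V (suc i) 1+i≤h k k<n =
    cong₂ _+ℤ_ (cong₂ (λ a b → a +ℤ -ℤ b) (V (suc (suc i)) (s≤s 1+i≤h) k k<n)
                                          (V (suc i) (ℕP.m≤n⇒m≤1+n 1+i≤h) k k<n))
               (V i (ℕP.m≤n⇒m≤1+n (ℕP.<⇒≤ 1+i≤h)) k k<n)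

  Δ-coefficient : ∀ {n} → Vanish n → ∀ i → i ≤ h → Δ E i n ≡ 0ℤ
  Δ-coefficient {n} V i i≤h = begin
      Δ E i n
    ≡⟨ sym (ℤP.*-identityˡ _) ⟩
      1ℤ *ℤ Δ E i n
    ≡⟨ cong (_*ℤ Δ E i n) (sym w₀) ⟩
      w 0 *ℤ Δ E i n
    ≡⟨ sym (leading-coefficient w (Δ E i) n (Δ-vanishes V i i≤h)) ⟩
      (w *ₛ Δ E i) n
    ≡⟨ equation i i≤h n ⟩
      0ₛ n +ℤ (v *ₛ ∇ E i) n
    ≡⟨ cong₂ _+ℤ_ (0ₛ-coeff n) (leading-coefficient v (∇ E i) n (∇-vanishes V i i≤h)) ⟩
      0ℤ +ℤ v 0 *ℤ ∇ E i n
    ≡⟨ cong (λ a → 0ℤ +ℤ a *ℤ ∇ E i n) v₀ ⟩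
      0ℤ +ℤ 0ℤ *ℤ ∇ E i n
    ≡⟨ ℤP.+-identityˡ _ ⟩
      0ℤ *ℤ ∇ E i n
    ≡⟨ ℤP.*-zeroˡ (∇ E i n) ⟩
      0ℤ
    ∎
    where open ≡-Reasoning

  next-degree : ∀ {n} → Vanish n → ∀ i → i ≤ h → E i n ≡ 0ℤ
  next-degree V zero    i≤h   = Δ-coefficient V 0 i≤h
  next-degree V (suc i) 1+i≤h =
    trans (ℤP.i-j≡0⇒i≡j _ _ (Δ-coefficient V (suc i) 1+i≤h)) (next-degree V i (ℕP.<⇒≤ 1+i≤h))

  vanish : ∀ n → Vanish n
  vanish zero    i _      k ()
  vanish (suc n) i i≤1+h k k<1+n with ℕP.m<1+n⇒m<n∨m≡n k<1+n
  ... | inj₁ k<n  = vanish n i i≤1+h k k<n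
  ... | inj₂ refl with ℕP.m≤n⇒m<n∨m≡n i≤1+h
  ...   | inj₁ i<1+h = next-degree (vanish n) i (ℕP.≤-pred i<1+h)
  ...   | inj₂ refl  = trans (boundary k) (0ₛ-coeff k)

  vanishes : ∀ i → i ≤ h → E i ≈ₛ 0ₛ
  vanishes i i≤h n = trans (vanish (suc n) i (ℕP.m≤n⇒m≤1+n i≤h) n ℕP.≤-refl) (sym (0ₛ-coeff n))

unique : ∀ {h w v c F G} → w 0 ≡ 1ℤ → v 0 ≡ 0ℤ →
  Solves h w v c F → Solves h w v c G → ∀ i → i ≤ h → F i ≈ₛ G i
unique w₀ v₀ F-solves G-solves i i≤h n =
  ℤP.i-j≡0⇒i≡j _ _ (trans (Uniqueness.vanishes w₀ v₀ (Solves-sub F-solves G-solves) i i≤h n)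
                           (0ₛ-coeff n))

scale-solution : ∀ {h w v c X} (K : PS) → v ≈ₛ zₛ *ₛ w → Solves h 𝟙 zₛ c X →
  Solves h w v (λ i → c i *ₛ (w *ₛ K)) (λ i → X i *ₛ K)
scale-solution {h} {w} {v} {c} {X} K v≈zw X-solves = record
  { equation = λ i i≤h → begin
      w *ₛ Δ (λ j → X j *ₛ K) i
    ≈⟨ *-congˡ {w} (Δ-scale X K i) ⟩
      w *ₛ (Δ X i *ₛ K)
    ≈⟨ solve 3 (λ w a k → w :* (a :* k) := (con 1ℤ :* a) :* (w :* k)) ≈-refl w (Δ X i) K ⟩
      (𝟙 *ₛ Δ X i) *ₛ (w *ₛ K)
    ≈⟨ *-congʳ {w *ₛ K} (equation i i≤h) ⟩
      (c i +ₛ zₛ *ₛ ∇ X i) *ₛ (w *ₛ K)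
    ≈⟨ solve 5 (λ c z w a k → (c :+ z :* a) :* (w :* k) := c :* (w :* k) :+ (z :* w) :* (a :* k))
         ≈-refl (c i) zₛ w (∇ X i) K ⟩
      c i *ₛ (w *ₛ K) +ₛ (zₛ *ₛ w) *ₛ (∇ X i *ₛ K)
    ≈⟨ +-congˡ {c i *ₛ (w *ₛ K)} (*-cong (≈-sym v≈zw) (≈-sym (∇-scale X K i))) ⟩
      c i *ₛ (w *ₛ K) +ₛ v *ₛ ∇ (λ j → X j *ₛ K) i
    ∎
  ; boundary = begin
      X (suc h) *ₛ K
    ≈⟨ *-congʳ {K} boundary ⟩
      0ₛ *ₛ K
    ≈⟨ solve 1 (λ k → con 0ℤ :* k := con 0ℤ) ≈-refl K ⟩
      0ₛ
    ∎
  }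
  where
  open Solves X-solves
  open ≈-Reasoning

-- The right-hand side (1, −1, 0, 0, …) of the strip system, coming from the
-- single path of length 0.
source : ℕ → ℤ
source 0             = 1ℤ
source 1             = -1ℤ
source (suc (suc _)) = 0ℤ

∸-step : ∀ {h j} → suc j ≤ h → h ∸ j ≡ suc (h ∸ suc j)
∸-step {suc h} {zero}  _          = refl
∸-step {suc h} {suc j} (s≤s 1+j≤h) = ∸-step 1+j≤h

-- Exponents are written so that powers of v unfold
-- definitionally; the `*-form` lemmas relate them to the theorem's form.
module ClosedForm (v : PS) where

  u : PS
  u = 𝟙 +ₛ v

  w : PS
  w = 𝟙 +ₛ v +ₛ v ^ₛ 2

  K : ℕ → PS
  K h = u *ₛ (𝟙 -ₛ v ^ₛ (3 + h))

  Ψ : ℕ → ℕ → PS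
  Ψ i d = v *ₛ w *ₛ u ^ₛ i *ₛ (𝟙 -ₛ v ^ₛ d)

  closed : ℕ → ℕ → PS
  closed h zero    = w *ₛ (𝟙 -ₛ v ^ₛ (2 + h))
  closed h (suc i) = Ψ i (h ∸ i)

  -- At an interior level, where the exponent d drops by one per level, the
  -- system reduces to one polynomial identity in v, v^d and uⁱ.
  interior-row : ∀ i {d₀ d₁ d₂} k → d₁ ≡ suc d₀ → d₂ ≡ suc d₁ →
    w *ₛ (Ψ (suc i) d₁ -ₛ Ψ i d₂)
      ≈ₛ const 0ℤ *ₛ k +ₛ v *ₛ (Ψ (suc (suc i)) d₀ -ₛ Ψ (suc i) d₁ +ₛ Ψ i d₂)
  interior-row i {d₀} k refl refl =
    solve 4 (λ v x y k →
      let U = con 1ℤ :+ v ; W = con 1ℤ :+ v :+ v :^ 2 in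
      W :* (v :* W :* (U :* y) :* (con 1ℤ :- v :* x) :- v :* W :* y :* (con 1ℤ :- v :* (v :* x)))
      := con 0ℤ :* k
         :+ v :* (v :* W :* (U :* (U :* y)) :* (con 1ℤ :- x)
                  :- v :* W :* (U :* y) :* (con 1ℤ :- v :* x)
                  :+ v :* W :* y :* (con 1ℤ :- v :* (v :* x))))
      ≈-refl v (v ^ₛ d₀) (u ^ₛ i) k

  closed-row : ∀ h i → i ≤ h →
    w *ₛ Δ (closed h) i ≈ₛ const (source i) *ₛ (w *ₛ K h) +ₛ v *ₛ ∇ (closed h) i
  closed-row h zero _ =
    solve 2 (λ v x →
      let U = con 1ℤ :+ v ; W = con 1ℤ :+ v :+ v :^ 2 in
      W :* (W :* (con 1ℤ :- v :* (v :* x)))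
      := con 1ℤ :* (W :* (U :* (con 1ℤ :- v :* (v :* (v :* x)))))
         :+ v :* (v :* W :* con 1ℤ :* (con 1ℤ :- x)))
      ≈-refl v (v ^ₛ h)
  closed-row zero    (suc zero) ()
  closed-row (suc h) (suc zero) _ =
    solve 2 (λ v x →
      let U = con 1ℤ :+ v ; W = con 1ℤ :+ v :+ v :^ 2 in
      W :* (v :* W :* con 1ℤ :* (con 1ℤ :- v :* x) :- W :* (con 1ℤ :- v :* (v :* (v :* x))))
      := con -1ℤ :* (W :* (U :* (con 1ℤ :- v :* (v :* (v :* (v :* x))))))
         :+ v :* (v :* W :* (U :* con 1ℤ) :* (con 1ℤ :- x)
                  :- v :* W :* con 1ℤ :* (con 1ℤ :- v :* x)
                  :+ W :* (con 1ℤ :- v :* (v :* (v :* x)))))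
      ≈-refl v (v ^ₛ h)
  closed-row h (suc (suc j)) 2+j≤h =
    interior-row j (w *ₛ K h) (∸-step 2+j≤h) (∸-step (ℕP.<⇒≤ 2+j≤h))

  -- Above the strip the closed form carries the factor 1 − v⁰ = 0.
  closed-top : ∀ h → closed h (suc h) ≈ₛ 0ₛ
  closed-top h rewrite ℕP.n∸n≡0 h =
    solve 2 (λ v y → let W = con 1ℤ :+ v :+ v :^ 2 in
      v :* W :* y :* (con 1ℤ :- con 1ℤ) := con 0ℤ) ≈-refl v (u ^ₛ h)

  closed-solves : ∀ h → Solves h w v (λ i → const (source i) *ₛ (w *ₛ K h)) (closed h)
  closed-solves h = record { equation = closed-row h ; boundary = closed-top h }

  closed-zero-form : ∀ h → closed h 0 ≡ w *ₛ (𝟙 -ₛ v ^ₛ (h + 2))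
  closed-zero-form h = cong (λ e → w *ₛ (𝟙 -ₛ v ^ₛ e)) (ℕP.+-comm 2 h)

  closed-suc-form : ∀ h i → closed h (suc i) ≡ Ψ i (h + 1 ∸ suc i)
  closed-suc-form h i = cong (λ m → Ψ i (m ∸ suc i)) (ℕP.+-comm 1 h)

  factor-form : ∀ h X → X *ₛ u *ₛ (𝟙 -ₛ v ^ₛ (h + 3)) ≈ₛ X *ₛ K h
  factor-form h X =
    ≈-trans (*ₛ-assoc X u (𝟙 -ₛ v ^ₛ (h + 3)))
            (≈-reflexive (cong (λ e → X *ₛ (u *ₛ (𝟙 -ₛ v ^ₛ e))) (ℕP.+-comm h 3)))

empty-count : ∀ {B : Set} → ¬ B → B ↔ Fin 0
empty-count ¬b = ↔-trans (mk↔ₛ′ ¬b (λ ()) (λ ()) (λ b → ⊥-elim (¬b b))) (↔-sym 0↔⊥)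

Below : ℕ → (ℕ → Set) → Set
Below i A = Σ[ j ∈ ℕ ] j < i × A j

sumBelow : (ℕ → ℕ) → ℕ → ℕ
sumBelow c zero    = 0
sumBelow c (suc i) = c i + sumBelow c i

Below-≡ : ∀ {A : ℕ → Set} {i j j′} {lt : j < i} {lt′ : j′ < i} {a : A j} {a′ : A j′} →
  (e : j ≡ j′) → subst A e a ≡ a′ → _≡_ {A = Below i A} (j , lt , a) (j′ , lt′ , a′)
Below-≡ refl refl = cong (λ lt → _ , lt , _) (ℕP.≤-irrelevant _ _)

Below-suc : ∀ {A : ℕ → Set} i → Below (suc i) A ↔ (A i ⊎ Below i A)
Below-suc {A} i = mk↔ₛ′ to from to∘from from∘to
  where
  to : Below (suc i) A → A i ⊎ Below i A
  to (j , j<1+i , a) with j ℕP.≟ i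
  ... | yes refl = inj₁ a
  ... | no j≢i   = inj₂ (j , ℕP.≤∧≢⇒< (ℕP.≤-pred j<1+i) j≢i , a)

  from : A i ⊎ Below i A → Below (suc i) A
  from (inj₁ a)             = i , ℕP.≤-refl , a
  from (inj₂ (j , j<i , a)) = j , ℕP.m≤n⇒m≤1+n j<i , a

  to∘from : ∀ x → to (from x) ≡ x
  to∘from (inj₁ a) with i ℕP.≟ i
  ... | yes refl = refl
  ... | no i≢i   = ⊥-elim (i≢i refl)
  to∘from (inj₂ (j , j<i , a)) with j ℕP.≟ i
  ... | yes refl = ⊥-elim (ℕP.<-irrefl refl j<i)
  ... | no _     = cong inj₂ (Below-≡ refl refl)

  from∘to : ∀ y → from (to y) ≡ y
  from∘to (j , j<1+i , a) with j ℕP.≟ i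
  ... | yes refl = Below-≡ refl refl
  ... | no _     = Below-≡ refl refl

Below-count : ∀ {A : ℕ → Set} {c : ℕ → ℕ} → (∀ j → A j ↔ Fin (c j)) →
  ∀ i → Below i A ↔ Fin (sumBelow c i)
Below-count count zero    = empty-count (λ ())
Below-count count (suc i) =
  ↔-trans (Below-suc i) (↔-trans (count i ⊎-↔ Below-count count i) (↔-sym +↔⊎))

length-∷ʳ : ∀ {A : Set} (s : List A) x → length (s ∷ʳ x) ≡ suc (length s)
length-∷ʳ s x = trans (length-++ s) (ℕP.+-comm (length s) 1)

module SnocDecomposition {A : Set} (Q : List A → Set)
                         (Q-irrelevant : ∀ {s} (p q : Q s) → p ≡ q) where

  Extended : ℕ → Set
  Extended n = Σ[ s ∈ List A ] length s ≡ n × Σ[ x ∈ A ] Q (s ∷ʳ x)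

  Extended-≡ : ∀ {n s s′ x x′} {l : length s ≡ n} {l′ : length s′ ≡ n}
    {q : Q (s ∷ʳ x)} {q′ : Q (s′ ∷ʳ x′)} →
    s ≡ s′ → x ≡ x′ → _≡_ {A = Extended n} (s , l , x , q) (s′ , l′ , x′ , q′)
  Extended-≡ {s = s} {x = x} refl refl =
    cong₂ (λ l q → s , l , x , q) (ℕP.≡-irrelevant _ _) (Q-irrelevant _ _)

  lastView : ∀ {n} (t : List A) → length t ≡ suc n → Σ[ s ∈ List A ] Σ[ x ∈ A ] s ∷ʳ x ≡ t
  lastView t        len with initLast t
  lastView .[]      ()  | []
  lastView .(s ∷ʳ x) _  | s ∷ʳ′ x = s , x , refl

  snoc-decomposition : ∀ n → (Σ[ t ∈ List A ] length t ≡ suc n × Q t) ↔ Extended n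
  snoc-decomposition n = mk↔ₛ′ to from to∘from from∘to
    where
    to : (Σ[ t ∈ List A ] length t ≡ suc n × Q t) → Extended n
    to (t , len , q) =
      let s , x , e = lastView t len in
      s , ℕP.suc-injective (trans (sym (length-∷ʳ s x)) (trans (cong length e) len)) ,
      x , subst Q (sym e) q

    from : Extended n → Σ[ t ∈ List A ] length t ≡ suc n × Q t
    from (s , len , x , q) = s ∷ʳ x , trans (length-∷ʳ s x) (cong suc len) , q

    to∘from : ∀ y → to (from y) ≡ y
    to∘from (s , len , x , q) =
      let s′ , x′ , e = lastView (s ∷ʳ x) (trans (length-∷ʳ s x) (cong suc len)) in
      Extended-≡ (∷ʳ-injectiveˡ s′ s e) (∷ʳ-injectiveʳ s′ s e)

    rebuild : ∀ {t} (len : length t ≡ suc n) (q : Q t)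
      (view : Σ[ s ∈ List A ] Σ[ x ∈ A ] s ∷ʳ x ≡ t) {len′} →
      _≡_ {A = Σ[ t ∈ List A ] length t ≡ suc n × Q t}
          (proj₁ view ∷ʳ proj₁ (proj₂ view) , len′ , subst Q (sym (proj₂ (proj₂ view))) q)
          (t , len , q)
    rebuild len q (s , x , refl) = cong (λ l → _ , l , q) (ℕP.≡-irrelevant _ _)

    from∘to : ∀ y → from (to y) ≡ y
    from∘to (t , len , q) = rebuild len q (lastView t len)

module StripPaths (h : ℕ) where

  start≤ : ∀ {a s i} → InStrip h a s i → a ≤ h
  start≤ (done a≤h)    = a≤h
  start≤ (stepD a≤h _) = a≤h
  start≤ (stepU a≤h _) = a≤h

  end≤ : ∀ {a s i} → InStrip h a s i → i ≤ h
  end≤ (done i≤h)  = i≤h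
  end≤ (stepD _ p) = end≤ p
  end≤ (stepU _ p) = end≤ p

  InStrip-irrelevant : ∀ {a s i} (p q : InStrip h a s i) → p ≡ q
  InStrip-irrelevant (done l)    (done l′)    = cong done (ℕP.≤-irrelevant l l′)
  InStrip-irrelevant (stepD l p) (stepD l′ q) = cong₂ stepD (ℕP.≤-irrelevant l l′) (InStrip-irrelevant p q)
  InStrip-irrelevant (stepU l p) (stepU l′ q) = cong₂ stepU (ℕP.≤-irrelevant l l′) (InStrip-irrelevant p q)

  InStrip-functional : ∀ {a s i j} → InStrip h a s i → InStrip h a s j → i ≡ j
  InStrip-functional (done _)    (done _)    = refl
  InStrip-functional (stepD _ p) (stepD _ q) = InStrip-functional p q
  InStrip-functional (stepU _ p) (stepU _ q) = InStrip-functional p q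

  StripPath-≡ : ∀ {n i} {π ρ : StripPath h n i} → proj₁ π ≡ proj₁ ρ → π ≡ ρ
  StripPath-≡ {π = s , l , p} {ρ = .s , l′ , p′} refl =
    cong₂ (λ l p → s , l , p) (ℕP.≡-irrelevant l l′) (InStrip-irrelevant p p′)

  split : ∀ s {a t i} → InStrip h a (s ++ t) i → Σ[ b ∈ ℕ ] InStrip h a s b × InStrip h b t i
  split []        p             = _ , done (start≤ p) , p
  split (D ∷ s)   (stepD a≤h p) = let b , q , r = split s p in b , stepD a≤h q , r
  split (U k ∷ s) (stepU a≤h p) = let b , q , r = split s p in b , stepU a≤h q , r

  join : ∀ {a s b t i} → InStrip h a s b → InStrip h b t i → InStrip h a (s ++ t) i
  join (done _)      q = q
  join (stepD a≤h p) q = stepD a≤h (join p q)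
  join (stepU a≤h p) q = stepU a≤h (join p q)

  removeD : ∀ {a s i} → InStrip h a (s ∷ʳ D) i → InStrip h a s (suc i)
  removeD {s = s} q with split s q
  ... | _ , p , stepD _ (done _) = p

  appendD : ∀ {a s i} → InStrip h a s (suc i) → InStrip h a (s ∷ʳ D) i
  appendD p = join p (stepD (end≤ p) (done (ℕP.<⇒≤ (end≤ p))))

  removeU : ∀ {a s k i} → InStrip h a (s ∷ʳ U k) i → Σ[ b ∈ ℕ ] InStrip h a s b × b + suc k ≡ i
  removeU {s = s} q with split s q
  ... | b , p , stepU _ (done _) = b , p , refl

  appendU : ∀ {a s k b i} → InStrip h a s b → b + suc k ≡ i → i ≤ h → InStrip h a (s ∷ʳ U k) i
  appendU p refl i≤h = join p (stepU (end≤ p) (done i≤h))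

  Below-path-≡ : ∀ {n i j j′} {lt : j < i} {lt′ : j′ < i}
    {π : StripPath h n j} {π′ : StripPath h n j′} →
    j ≡ j′ → proj₁ π ≡ proj₁ π′ → _≡_ {A = Below i (StripPath h n)} (j , lt , π) (j′ , lt′ , π′)
  Below-path-≡ refl e = Below-≡ refl (StripPath-≡ e)

  -- Cutting off the last step: a path of length n+1 ending at i ≤ h is a
  -- path of length n ending at i+1 followed by a down-step, or a path of
  -- length n ending at some j < i followed by the up-step of height i − j.
  last-step : ∀ n i → i ≤ h →
    StripPath h (suc n) i ↔ (StripPath h n (suc i) ⊎ Below i (StripPath h n))
  last-step n i i≤h = ↔-trans (snoc-decomposition n) (mk↔ₛ′ to from to∘from from∘to)
    where
    open SnocDecomposition (λ t → InStrip h 0 t i) InStrip-irrelevant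

    below : ∀ {b k} → b + suc k ≡ i → b < i
    below {b} refl = ℕP.m<m+n b (s≤s z≤n)

    rise : ∀ {j} → j < i → j + suc (i ∸ suc j) ≡ i
    rise {j} j<i = trans (ℕP.+-suc j (i ∸ suc j)) (ℕP.m+[n∸m]≡n j<i)

    height : ∀ {b k} → b + suc k ≡ i → i ∸ suc b ≡ k
    height {b} {k} refl = trans (cong (_∸ suc b) (ℕP.+-suc b k)) (ℕP.m+n∸m≡n (suc b) k)

    to : Extended n → StripPath h n (suc i) ⊎ Below i (StripPath h n)
    to (s , l , D , q)   = inj₁ (s , l , removeD q)
    to (s , l , U k , q) = let b , p , e = removeU q in inj₂ (b , below e , (s , l , p))

    from : StripPath h n (suc i) ⊎ Below i (StripPath h n) → Extended n
    from (inj₁ (s , l , p))             = s , l , D , appendD p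
    from (inj₂ (j , j<i , (s , l , p))) = s , l , U (i ∸ suc j) , appendU p (rise j<i) i≤h

    to∘from : ∀ y → to (from y) ≡ y
    to∘from (inj₁ π)                       = cong inj₁ (StripPath-≡ refl)
    to∘from (inj₂ (j , j<i , (s , l , p))) =
      cong inj₂ (Below-path-≡ (InStrip-functional (proj₁ (proj₂ (removeU (appendU p (rise j<i) i≤h)))) p)
                              refl)

    from∘to : ∀ x → from (to x) ≡ x
    from∘to (s , l , D , q)   = Extended-≡ refl refl
    from∘to (s , l , U k , q) = Extended-≡ refl (cong U (height (proj₂ (proj₂ (removeU q)))))

initial : ℕ → ℕ
initial zero    = 1
initial (suc _) = 0

module Counting (h : ℕ) (ψ : ℕ → ℕ → ℕ)
                (ψ-counts : ∀ i n → i ≤ h → StripPath h n i ↔ Fin (ψ i n)) where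
  open StripPaths h

  zero-length : ∀ i → StripPath h 0 i ↔ Fin (initial i)
  zero-length zero    = ↔-trans (mk↔ₛ′ (λ _ → tt) (λ _ → [] , refl , done z≤n) (λ _ → refl) empty-path)
                                (↔-sym 1↔⊤)
    where
    empty-path : ∀ π → ([] , refl , done z≤n) ≡ π
    empty-path ([] , refl , _) = StripPath-≡ refl
  zero-length (suc i) = empty-count λ { ([] , refl , ()) }

  P : ℕ → ℕ → ℕ
  P i n with i ℕP.≤? h
  ... | yes _ = ψ i n
  ... | no _  = 0

  P-counts : ∀ i n → StripPath h n i ↔ Fin (P i n)
  P-counts i n with i ℕP.≤? h
  ... | yes i≤h = ψ-counts i n i≤h
  ... | no i≰h  = empty-count (λ π → i≰h (end≤ (proj₂ (proj₂ π))))

  P≡ψ : ∀ i n → i ≤ h → P i n ≡ ψ i n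
  P≡ψ i n i≤h with i ℕP.≤? h
  ... | yes _   = refl
  ... | no i≰h  = ⊥-elim (i≰h i≤h)

  P-above : ∀ n → P (suc h) n ≡ 0
  P-above n with suc h ℕP.≤? h
  ... | yes 1+h≤h = ⊥-elim (ℕP.1+n≰n 1+h≤h)
  ... | no _      = refl

  P-initial : ∀ i → P i 0 ≡ initial i
  P-initial i = ↔⇒≡ (↔-trans (↔-sym (P-counts i 0)) (zero-length i))

  P-step : ∀ i n → i ≤ h → P i (suc n) ≡ P (suc i) n + sumBelow (λ j → P j n) i
  P-step i n i≤h =
    ↔⇒≡ (↔-trans (↔-sym (P-counts i (suc n)))
        (↔-trans (last-step n i i≤h)
        (↔-trans (P-counts (suc i) n ⊎-↔ Below-count (λ j → P-counts j n) i)
                 (↔-sym +↔⊎))))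

  X : ℕ → PS
  X i = ofℕ (P i)

  Δ-initial : ∀ i → Δ X i 0 ≡ source i
  Δ-initial zero          = cong +_ (P-initial 0)
  Δ-initial (suc zero)    = cong₂ (λ a b → + a +ℤ -ℤ + b) (P-initial 1) (P-initial 0)
  Δ-initial (suc (suc j)) = cong₂ (λ a b → + a +ℤ -ℤ + b) (P-initial (suc (suc j))) (P-initial (suc j))

  Δ-step : ∀ i → i ≤ h → ∀ n → Δ X i (suc n) ≡ ∇ X i n
  Δ-step zero    _     n = cong +_ (trans (P-step 0 n z≤n) (ℕP.+-identityʳ _))
  Δ-step (suc j) 1+j≤h n =
    trans (cong₂ (λ a b → + a +ℤ -ℤ + b) (P-step (suc j) n 1+j≤h) (P-step j n (ℕP.<⇒≤ 1+j≤h)))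
          (level-difference (P (suc (suc j)) n) (P (suc j) n) (P j n) (sumBelow (λ k → P k n) j))

  X-solves : Solves h 𝟙 zₛ (λ i → const (source i)) X
  X-solves = record
    { equation = λ i i≤h → ≈-trans (*ₛ-identityˡ (Δ X i)) (by-shift (Δ-initial i) (Δ-step i i≤h))
    ; boundary = λ n → trans (cong +_ (P-above n)) (sym (0ₛ-coeff n))
    }

mainTheorem5 : (v : PS) → v 0 ≡ 0ℤ → v ≈ₛ zₛ *ₛ (𝟙 +ₛ v +ₛ v ^ₛ 2) →
    (h : ℕ) → (ψ : ℕ → ℕ → ℕ) →
    (∀ i n → i ≤ h → StripPath h n i ↔ Fin (ψ i n)) →
    (ofℕ (ψ 0) *ₛ (𝟙 +ₛ v) *ₛ (𝟙 -ₛ v ^ₛ (h + 3))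
       ≈ₛ (𝟙 +ₛ v +ₛ v ^ₛ 2) *ₛ (𝟙 -ₛ v ^ₛ (h + 2)))
    × (∀ i → 1 ≤ i → i ≤ h →
         ofℕ (ψ i) *ₛ (𝟙 +ₛ v) *ₛ (𝟙 -ₛ v ^ₛ (h + 3))
           ≈ₛ v *ₛ (𝟙 +ₛ v +ₛ v ^ₛ 2) *ₛ (𝟙 +ₛ v) ^ₛ (i ∸ 1) *ₛ (𝟙 -ₛ v ^ₛ (h + 1 ∸ i)))
mainTheorem5 v v₀ v≈zw h ψ ψ-counts =
    ≈-trans (level 0 z≤n) (≈-reflexive (closed-zero-form h))
  , λ { zero () ; (suc i) _ i≤h → ≈-trans (level (suc i) i≤h) (≈-reflexive (closed-suc-form h i)) }
  where
  open ClosedForm v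
  open Counting h ψ ψ-counts

  w₀ : w 0 ≡ 1ℤ
  w₀ rewrite v₀ = refl

  agree : ∀ i → i ≤ h → X i *ₛ K h ≈ₛ closed h i
  agree = unique w₀ v₀ (scale-solution (K h) v≈zw X-solves) (closed-solves h)

  level : ∀ i → i ≤ h → ofℕ (ψ i) *ₛ u *ₛ (𝟙 -ₛ v ^ₛ (h + 3)) ≈ₛ closed h i
  level i i≤h =
    ≈-trans (factor-form h (ofℕ (ψ i)))
   (≈-trans (*-congʳ {K h} (λ n → cong +_ (sym (P≡ψ i n i≤h))))
            (agree i i≤h))
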